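{- Let $\lambda$ be a partition, $n$ a positive integer, $T\in\mathrm{SVT}(\lambda,n)$, and let $\mu$ be the largest strict partition contained in $\lambda$. Then there exists $S\in\mathrm{SVT}(\mu,n)$ with $d(S)=d(T)$.
   Context: Partitions are drawn in French convention: row $i$ (from the bottom) has boxes $(i,1),\dots,(i,\lambda_i)$; the box above $(i,j)$ is $(i+1,j)$ and the box to its right is $(i,j+1)$. A strict partition has distinct nonzero parts; containment means $\mu_i\le\lambda_i$ for all $i$, and the largest strict partition contained in $\lambda$ is the one of maximal size. A set-valued tableau of shape $\lambda$ assigns to each box $\mathsf B$ a nonempty finite set $T(\mathsf B)$ of positive integers such that $\max T(\mathsf B)<\min T(\text{box above})$ and $\max T(\mathsf B)\le\min T(\text{box to the right})$ whenever those boxes exist. $\mathrm{SVT}(\lambda,n)$: such tableaux with entries in $\{1,\dots,n\}$; $d(T)=\sum_{\mathsf B}|T(\mathsf B)|$. -}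

module Defs where

open import Data.Nat using (ℕ; zero; suc; _+_; _≤_; _<_; _>_; _≥_)
open import Data.List using (List; []; _∷_; length; map; upTo)
open import Data.Nat.ListAction using (sum)
open import Data.List.Relation.Unary.All using (All)
open import Data.List.Relation.Unary.Linked using (Linked)
open import Data.Fin using (Fin; toℕ)
open import Data.Fin.Subset using (Subset; _∈_; Nonempty; ∣_∣)
open import Data.Product using (_×_)

-- A partition is a list of parts λ₁ ≥ λ₂ ≥ … > 0 (rows listed from the bottom).
IsPartition : List ℕ → Set
IsPartition λs = Linked _≥_ λs × All (λ p → 0 < p) λs

IsStrictPartition : List ℕ → Set
IsStrictPartition λs = Linked _>_ λs × All (λ p → 0 < p) λs

rowLen : List ℕ → ℕ → ℕ
rowLen []       _       = 0
rowLen (p ∷ ps) zero    = p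
rowLen (p ∷ ps) (suc i) = rowLen ps i

_⊆ₚ_ : List ℕ → List ℕ → Set
μ ⊆ₚ λs = ∀ i → rowLen μ i ≤ rowLen λs i

size : List ℕ → ℕ
size = sum

InShape : List ℕ → ℕ → ℕ → Set
InShape λs i j = j < rowLen λs i

-- A filling assigns to each cell a subset of {1,…,n}, encoded as Subset n
-- (element k : Fin n stands for the integer toℕ k + 1; order is preserved).
Filling : ℕ → Set
Filling n = ℕ → ℕ → Subset n

-- Set-valued tableau of shape λ with entries in {1,…,n}.
-- "max A < min B" for nonempty A, B is written as ∀ a ∈ A, ∀ b ∈ B, a < b.
record IsSVT (λs : List ℕ) (n : ℕ) (T : Filling n) : Set where
  field
    nonempty : ∀ i j → InShape λs i j → Nonempty (T i j)
    colStrict : ∀ i j → InShape λs i j → InShape λs (suc i) j →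
                ∀ (a b : Fin n) → a ∈ T i j → b ∈ T (suc i) j → toℕ a < toℕ b
    rowWeak : ∀ i j → InShape λs i j → InShape λs i (suc j) →
              ∀ (a b : Fin n) → a ∈ T i j → b ∈ T i (suc j) → toℕ a ≤ toℕ b

d : (λs : List ℕ) {n : ℕ} → Filling n → ℕ
d λs T = sum (map (λ i → sum (map (λ j → ∣ T i j ∣) (upTo (rowLen λs i)))) (upTo (length λs)))

-- The degree d can take every value from |μ| to |μ| + Σ_{i<ℓ(μ)} (n − 1 − i) on SVT(μ, n): put the
-- entry i + 1 in every box of row i and enlarge the last box of the row to an interval of length at
-- most n − i.  So it suffices to show that d(T) lies in this range.  The lower bound holds because
-- every box carries an entry.  For the upper bound, maximality of μ forces every box of λ outside μ
-- to lie in the column above the last box of some row i of μ (otherwise one more box could be added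
-- to μ), so λ is covered by the hooks formed by row i of μ and the column above its last box.  Along
-- such a hook the entry sets form a chain, weakly increasing along the row and strictly increasing up
-- the column, that starts at i + 1 or above and ends at n or below; hence the hook carries at most
-- μᵢ + (n − 1 − i) entries.

module Submission where

open import Defs
open import Data.Nat
open import Data.Nat.Properties
open import Data.Nat.ListAction using (sum)
open import Data.Nat.Tactic.RingSolver using (solve-∀)
open import Data.List using (List; []; _∷_; length; map; upTo; applyUpTo)
open import Data.List.Relation.Unary.All using (All; []; _∷_)
open import Data.List.Relation.Unary.Linked using (Linked; []; [-]; _∷_)
open import Data.Fin using (Fin; toℕ; fromℕ<) renaming (zero to fzero; suc to fsuc)
open import Data.Fin.Properties using (toℕ<n; toℕ-fromℕ<)
open import Data.Fin.Subset using (Subset; _∈_; _⊆_; Nonempty; ∣_∣; inside; outside)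
open import Data.Fin.Subset.Properties using (p⊆q⇒∣p∣≤∣q∣; x∈p⇒∣p-x∣<∣p∣; nonempty?)
open import Data.Vec using ([]; _∷_; here; there)
open import Data.Product using (Σ; _×_; _,_; proj₁; proj₂)
open import Data.Sum using (_⊎_; inj₁; inj₂)
open import Data.Unit using (⊤; tt)
open import Function using (_∘_)
open import Relation.Nullary using (Dec; yes; no; ¬_; contradiction)
open import Relation.Unary using (Decidable)
open import Relation.Binary.PropositionalEquality

∑ : ℕ → (ℕ → ℕ) → ℕ
∑ zero    f = 0
∑ (suc N) f = ∑ N f + f N

syntax ∑ N (λ i → e) = ∑[ i < N ] e

∑-head : ∀ N (f : ℕ → ℕ) → ∑[ i < suc N ] f i ≡ f 0 + ∑[ i < N ] f (suc i)
∑-head zero    f = sym (+-identityʳ (f 0))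
∑-head (suc N) f = begin
  ∑ N f + f N + f (suc N)                 ≡⟨ cong (_+ f (suc N)) (∑-head N f) ⟩
  f 0 + ∑[ i < N ] f (suc i) + f (suc N)  ≡⟨ +-assoc (f 0) _ _ ⟩
  f 0 + ∑[ i < suc N ] f (suc i)          ∎
  where open ≡-Reasoning

∑-applyUpTo : ∀ (f g : ℕ → ℕ) N → sum (map f (applyUpTo g N)) ≡ ∑[ i < N ] f (g i)
∑-applyUpTo f g zero    = refl
∑-applyUpTo f g (suc N) =
  trans (cong (f (g 0) +_) (∑-applyUpTo f (g ∘ suc) N)) (sym (∑-head N (f ∘ g)))

∑-upTo : ∀ (f : ℕ → ℕ) N → sum (map f (upTo N)) ≡ ∑ N f
∑-upTo f = ∑-applyUpTo f (λ i → i)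

∑-cong : ∀ N {f g : ℕ → ℕ} → (∀ i → i < N → f i ≡ g i) → ∑ N f ≡ ∑ N g
∑-cong zero    f≡g = refl
∑-cong (suc N) f≡g = cong₂ _+_ (∑-cong N (λ i i<N → f≡g i (m≤n⇒m≤1+n i<N))) (f≡g N ≤-refl)

∑-mono : ∀ N {f g : ℕ → ℕ} → (∀ i → i < N → f i ≤ g i) → ∑ N f ≤ ∑ N g
∑-mono zero    f≤g = z≤n
∑-mono (suc N) f≤g = +-mono-≤ (∑-mono N (λ i i<N → f≤g i (m≤n⇒m≤1+n i<N))) (f≤g N ≤-refl)

∑-monoˡ : ∀ (f : ℕ → ℕ) {M N} → M ≤ N → ∑ M f ≤ ∑ N f
∑-monoˡ f {N = zero}  z≤n = z≤n
∑-monoˡ f {M} {suc N} M≤1+N with M ≟ suc N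
... | yes refl = ≤-refl
... | no  M≢  = ≤-trans (∑-monoˡ f (≤-pred (≤∧≢⇒< M≤1+N M≢))) (m≤m+n (∑ N f) (f N))

∑-zero : ∀ N {f : ℕ → ℕ} → (∀ i → i < N → f i ≡ 0) → ∑ N f ≡ 0
∑-zero zero    f≡0 = refl
∑-zero (suc N) f≡0 = cong₂ _+_ (∑-zero N (λ i i<N → f≡0 i (m≤n⇒m≤1+n i<N))) (f≡0 N ≤-refl)

∑-const : ∀ N c → ∑[ i < N ] c ≡ N * c
∑-const zero    c = refl
∑-const (suc N) c = trans (cong (_+ c) (∑-const N c)) (+-comm (N * c) c)

∑-distrib-+ : ∀ N (f g : ℕ → ℕ) → ∑[ i < N ] (f i + g i) ≡ ∑ N f + ∑ N g
∑-distrib-+ zero    f g = refl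
∑-distrib-+ (suc N) f g = begin
  ∑[ i < N ] (f i + g i) + (f N + g N)  ≡⟨ cong (_+ (f N + g N)) (∑-distrib-+ N f g) ⟩
  ∑ N f + ∑ N g + (f N + g N)           ≡⟨ interchange (∑ N f) (∑ N g) (f N) (g N) ⟩
  ∑ N f + f N + (∑ N g + g N)           ∎
  where
  open ≡-Reasoning
  interchange : ∀ a b c e → a + b + (c + e) ≡ a + c + (b + e)
  interchange = solve-∀

∑-comm : ∀ N M (f : ℕ → ℕ → ℕ) → ∑[ i < N ] ∑[ j < M ] f i j ≡ ∑[ j < M ] ∑[ i < N ] f i j
∑-comm zero    M f = sym (∑-zero M (λ _ _ → refl))
∑-comm (suc N) M f = begin
  ∑[ i < N ] ∑[ j < M ] f i j + ∑[ j < M ] f N j  ≡⟨ cong (_+ ∑[ j < M ] f N j) (∑-comm N M f) ⟩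
  ∑[ j < M ] ∑[ i < N ] f i j + ∑[ j < M ] f N j  ≡⟨ sym (∑-distrib-+ M _ _) ⟩
  ∑[ j < M ] ∑[ i < suc N ] f i j                 ∎
  where open ≡-Reasoning

term≤∑ : ∀ N (f : ℕ → ℕ) i → i < N → f i ≤ ∑ N f
term≤∑ (suc N) f i i<1+N with i ≟ N
... | yes refl = m≤n+m (f N) (∑ N f)
... | no  i≢N  = ≤-trans (term≤∑ N f i (≤-pred (≤∧≢⇒< i<1+N (i≢N ∘ suc-injective))))
                         (m≤m+n (∑ N f) (f N))

∑-truncate : ∀ {f : ℕ → ℕ} K N → K ≤ N → (∀ i → K ≤ i → i < N → f i ≡ 0) → ∑ N f ≡ ∑ K f
∑-truncate K zero    z≤n    _   = refl
∑-truncate K (suc N) K≤1+N f≡0 with K ≟ suc N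
... | yes refl = refl
... | no  K≢   = trans (cong₂ _+_ (∑-truncate K N K≤N (λ i K≤i i<N → f≡0 i K≤i (m≤n⇒m≤1+n i<N)))
                                  (f≡0 N K≤N ≤-refl))
                       (+-identityʳ _)
  where K≤N = ≤-pred (≤∧≢⇒< K≤1+N K≢)

onlyIf : {P : Set} → Dec P → ℕ → ℕ
onlyIf (yes _) x = x
onlyIf (no  _) x = 0

onlyIf-yes : ∀ {P : Set} (P? : Dec P) {x} → P → onlyIf P? x ≡ x
onlyIf-yes (yes _) p = refl
onlyIf-yes (no ¬p) p = contradiction p ¬p

onlyIf-no : ∀ {P : Set} (P? : Dec P) {x} → ¬ P → onlyIf P? x ≡ 0
onlyIf-no (yes p) ¬p = contradiction p ¬p
onlyIf-no (no  _) ¬p = refl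

onlyIf-≤ : ∀ {P : Set} (P? : Dec P) {x y} → (P → x ≤ y) → onlyIf P? x ≤ y
onlyIf-≤ (yes p) x≤y = x≤y p
onlyIf-≤ (no  _) x≤y = z≤n

∑-onlyIf-< : ∀ (f : ℕ → ℕ) K N → K ≤ N → ∑[ i < N ] onlyIf (i <? K) (f i) ≡ ∑ K f
∑-onlyIf-< f K N K≤N = begin
  ∑[ i < N ] onlyIf (i <? K) (f i)  ≡⟨ ∑-truncate K N K≤N (λ i K≤i _ → onlyIf-no (i <? K) (≤⇒≯ K≤i)) ⟩
  ∑[ i < K ] onlyIf (i <? K) (f i)  ≡⟨ ∑-cong K (λ i i<K → onlyIf-yes (i <? K) i<K) ⟩
  ∑ K f                             ∎
  where open ≡-Reasoning

∑-onlyIf-≡ : ∀ (f : ℕ → ℕ) k N → k < N → ∑[ i < N ] onlyIf (i ≟ k) (f i) ≡ f k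
∑-onlyIf-≡ f k (suc N) k<1+N with N ≟ k
... | yes refl = cong (_+ f k) (∑-zero k (λ i i<k → onlyIf-no (i ≟ k) (<⇒≢ i<k)))
... | no  N≢k  = trans (+-identityʳ _) (∑-onlyIf-≡ f k N (≤∧≢⇒< (≤-pred k<1+N) (N≢k ∘ sym)))

∑-onlyIf-> : ∀ (f : ℕ → ℕ) i M → ∑[ r < M + suc i ] onlyIf (i <? r) (f r) ≡ ∑[ s < M ] f (s + suc i)
∑-onlyIf-> f i zero    = ∑-zero (suc i) (λ r r≤i → onlyIf-no (i <? r) (≤⇒≯ (≤-pred r≤i)))
∑-onlyIf-> f i (suc M) = cong₂ _+_ (∑-onlyIf-> f i M) (onlyIf-yes (i <? M + suc i) (m≤n+m (suc i) M))

-- The bound is written len + lo, not lo + len, so that suc len + lo reduces.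
interval : ∀ {n} (lo len : ℕ) → Subset n
interval {zero}  _        _         = []
interval {suc n} (suc lo) len       = outside ∷ interval lo len
interval {suc n} zero     zero      = outside ∷ interval zero zero
interval {suc n} zero     (suc len) = inside ∷ interval zero len

∈-interval⁻ : ∀ {n} lo len (a : Fin n) → a ∈ interval lo len → lo ≤ toℕ a × toℕ a < len + lo
∈-interval⁻ {suc n} (suc lo) len (fsuc a) (there a∈) with ∈-interval⁻ lo len a a∈
... | lo≤a , a<len+lo = s≤s lo≤a , subst (suc (toℕ a) <_) (sym (+-suc len lo)) (s≤s a<len+lo)
∈-interval⁻ {suc n} zero zero      (fsuc a) (there a∈) = contradiction (proj₂ (∈-interval⁻ zero zero a a∈)) (λ ())
∈-interval⁻ {suc n} zero (suc len) fzero    here       = z≤n , s≤s z≤n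
∈-interval⁻ {suc n} zero (suc len) (fsuc a) (there a∈) = z≤n , s≤s (proj₂ (∈-interval⁻ zero len a a∈))

∈-interval⁺ : ∀ {n} lo len (a : Fin n) → lo ≤ toℕ a → toℕ a < len + lo → a ∈ interval lo len
∈-interval⁺ {suc n} (suc lo) len (fsuc a) (s≤s lo≤a) a<len+lo =
  there (∈-interval⁺ lo len a lo≤a (≤-pred (subst (suc (toℕ a) <_) (+-suc len lo) a<len+lo)))
∈-interval⁺ {suc n} zero zero      a        _ a<0        = contradiction a<0 (λ ())
∈-interval⁺ {suc n} zero (suc len) fzero    _ _          = here
∈-interval⁺ {suc n} zero (suc len) (fsuc a) _ (s≤s a<len) = there (∈-interval⁺ zero len a z≤n a<len)

∣interval∣ : ∀ {n} lo len → len + lo ≤ n → ∣ interval {n} lo len ∣ ≡ len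
∣interval∣ {zero}  zero     zero      _ = refl
∣interval∣ {suc n} (suc lo) len       fits = ∣interval∣ lo len (≤-pred (subst (_≤ suc n) (+-suc len lo) fits))
∣interval∣ {suc n} zero     zero      _ = ∣interval∣ {n} zero zero z≤n
∣interval∣ {suc n} zero     (suc len) (s≤s fits) = cong suc (∣interval∣ zero len fits)

∣interval∣≤ : ∀ {n} lo len → ∣ interval {n} lo len ∣ ≤ len
∣interval∣≤ {zero}  _        _         = z≤n
∣interval∣≤ {suc n} (suc lo) len       = ∣interval∣≤ {n} lo len
∣interval∣≤ {suc n} zero     zero      = ∣interval∣≤ {n} zero zero
∣interval∣≤ {suc n} zero     (suc len) = s≤s (∣interval∣≤ {n} zero len)

nonempty⇒∣p∣>0 : ∀ {n} (p : Subset n) → Nonempty p → 0 < ∣ p ∣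
nonempty⇒∣p∣>0 p (x , x∈p) = ≤-trans (s≤s z≤n) (x∈p⇒∣p-x∣<∣p∣ x∈p)

∣p∣+lo≤1+hi : ∀ {n} (p : Subset n) lo hi → Nonempty p →
              (∀ a → a ∈ p → lo ≤ toℕ a) → (∀ a → a ∈ p → toℕ a ≤ hi) → ∣ p ∣ + lo ≤ suc hi
∣p∣+lo≤1+hi {n} p lo hi (x , x∈p) lo≤ ≤hi = begin
  ∣ p ∣ + lo
    ≤⟨ +-monoˡ-≤ lo (≤-trans (p⊆q⇒∣p∣≤∣q∣ p⊆I) (∣interval∣≤ {n} lo (suc hi ∸ lo))) ⟩
  (suc hi ∸ lo) + lo
    ≡⟨ m∸n+n≡m lo≤1+hi ⟩
  suc hi ∎
  where
  open ≤-Reasoning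
  lo≤1+hi : lo ≤ suc hi
  lo≤1+hi = m≤n⇒m≤1+n (≤-trans (lo≤ x x∈p) (≤hi x x∈p))
  p⊆I : p ⊆ interval lo (suc hi ∸ lo)
  p⊆I {a} a∈p = ∈-interval⁺ lo _ a (lo≤ a a∈p)
                  (subst (toℕ a <_) (sym (m∸n+n≡m lo≤1+hi)) (s≤s (≤hi a a∈p)))

max : ∀ {n} → Subset n → ℕ
max []      = 0
max (_ ∷ p) with nonempty? p
... | yes _ = suc (max p)
... | no  _ = 0

max-upper : ∀ {n} (p : Subset n) a → a ∈ p → toℕ a ≤ max p
max-upper (_ ∷ p) fzero     _          = z≤n
max-upper (_ ∷ p) (fsuc a) (there a∈p) with nonempty? p
... | yes _  = s≤s (max-upper p a a∈p)
... | no  ∅p = contradiction (a , a∈p) ∅p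

max-∈ : ∀ {n} (p : Subset n) → Nonempty p → Σ (Fin n) λ a → a ∈ p × toℕ a ≡ max p
max-∈ (b ∷ p) (x , x∈) with nonempty? p
... | yes ne with max-∈ p ne
...   | a , a∈p , a≡max = fsuc a , there a∈p , cong suc a≡max
max-∈ (b ∷ p) (fzero  , here)      | no _  = fzero , here , refl
max-∈ (b ∷ p) (fsuc x , there x∈p) | no ∅p = contradiction (x , x∈p) ∅p

max-satisfies : ∀ {n} (Q : ℕ → Set) (p : Subset n) → Nonempty p → (∀ a → a ∈ p → Q (toℕ a)) → Q (max p)
max-satisfies Q p ne Qp with max-∈ p ne
... | a , a∈p , a≡max = subst Q a≡max (Qp a a∈p)

weakChain-card : ∀ {n} (A : ℕ → Subset n) k lo →
                 (∀ j → j ≤ k → Nonempty (A j)) →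
                 (∀ j → j < k → ∀ a b → a ∈ A j → b ∈ A (suc j) → toℕ a ≤ toℕ b) →
                 (∀ a → a ∈ A 0 → lo ≤ toℕ a) →
                 ∑[ j < suc k ] ∣ A j ∣ + lo ≤ suc k + max (A k)
weakChain-card A zero lo ne _ lo≤ = ∣p∣+lo≤1+hi (A 0) lo (max (A 0)) (ne 0 z≤n) lo≤ (max-upper (A 0))
weakChain-card A (suc k) lo ne step lo≤ = begin
  ∑[ j < suc k ] ∣ A j ∣ + ∣ A (suc k) ∣ + lo
    ≡⟨ swap₂₃ (∑[ j < suc k ] ∣ A j ∣) ∣ A (suc k) ∣ lo ⟩
  ∑[ j < suc k ] ∣ A j ∣ + lo + ∣ A (suc k) ∣
    ≤⟨ +-monoˡ-≤ _ (weakChain-card A k lo (λ j j≤k → ne j (m≤n⇒m≤1+n j≤k))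
        (λ j j<k → step j (m≤n⇒m≤1+n j<k)) lo≤) ⟩
  suc k + max (A k) + ∣ A (suc k) ∣
    ≡⟨ swapInner (suc k) (max (A k)) _ ⟩
  suc k + (∣ A (suc k) ∣ + max (A k))
    ≤⟨ +-monoʳ-≤ (suc k) lastStep ⟩
  suc k + suc (max (A (suc k)))
    ≡⟨ +-suc (suc k) _ ⟩
  suc (suc k) + max (A (suc k)) ∎
  where
  open ≤-Reasoning
  swap₂₃ : ∀ a b c → a + b + c ≡ a + c + b
  swap₂₃ = solve-∀
  swapInner : ∀ a b c → a + b + c ≡ a + (c + b)
  swapInner = solve-∀
  lastStep : ∣ A (suc k) ∣ + max (A k) ≤ suc (max (A (suc k)))
  lastStep = ∣p∣+lo≤1+hi (A (suc k)) (max (A k)) _ (ne (suc k) ≤-refl) max≤next (max-upper (A (suc k)))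
    where
    max≤next : ∀ b → b ∈ A (suc k) → max (A k) ≤ toℕ b
    max≤next b b∈ = max-satisfies (_≤ toℕ b) (A k) (ne k (n≤1+n k)) (λ a a∈ → step k ≤-refl a b a∈ b∈)

strictChain-card : ∀ {n} (A : ℕ → Subset n) {P : ℕ → Set} (P? : Decidable P) →
                   (∀ s → P (suc s) → P s) →
                   (∀ s → P s → Nonempty (A s)) →
                   (∀ s → P (suc s) → ∀ a b → a ∈ A s → b ∈ A (suc s) → toℕ a < toℕ b) →
                   ∀ lo → lo ≤ n → (P 0 → ∀ a → a ∈ A 0 → lo ≤ toℕ a) →
                   ∀ K → ∑[ s < K ] onlyIf (P? s) ∣ A s ∣ + lo ≤ n
strictChain-card A P? down ne step lo lo≤n lo≤ zero    = lo≤n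
strictChain-card {n} A {P} P? down ne step lo lo≤n lo≤ (suc K) = begin
  ∑[ s < suc K ] onlyIf (P? s) ∣ A s ∣ + lo
    ≡⟨ cong (_+ lo) (∑-head K (λ s → onlyIf (P? s) ∣ A s ∣)) ⟩
  onlyIf (P? 0) ∣ A 0 ∣ + ∑[ s < K ] onlyIf (P? (suc s)) ∣ A (suc s) ∣ + lo
    ≤⟨ fromFirst (P? 0) ⟩
  n ∎
  where
  open ≤-Reasoning
  rest = ∑[ s < K ] onlyIf (P? (suc s)) ∣ A (suc s) ∣
  chainAbove : ∀ lo′ → lo′ ≤ n → (P 1 → ∀ a → a ∈ A 1 → lo′ ≤ toℕ a) → rest + lo′ ≤ n
  chainAbove lo′ lo′≤n lo′≤ =
    strictChain-card (A ∘ suc) (P? ∘ suc) (down ∘ suc) (ne ∘ suc) (step ∘ suc) lo′ lo′≤n lo′≤ K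
  fromFirst : (P0? : Dec (P 0)) → onlyIf P0? ∣ A 0 ∣ + rest + lo ≤ n
  fromFirst (yes p0) = begin
    ∣ A 0 ∣ + rest + lo
      ≡⟨ swap₁₂ ∣ A 0 ∣ rest lo ⟩
    rest + (∣ A 0 ∣ + lo)
      ≤⟨ +-monoʳ-≤ rest (∣p∣+lo≤1+hi (A 0) lo (max (A 0)) (ne 0 p0) (lo≤ p0) (max-upper (A 0))) ⟩
    rest + suc (max (A 0))
      ≤⟨ chainAbove (suc (max (A 0))) (max-satisfies (_< n) (A 0) (ne 0 p0) (λ a _ → toℕ<n a))
          (λ p1 b b∈ → max-satisfies (_< toℕ b) (A 0) (ne 0 p0) (λ a a∈ → step 0 p1 a b a∈ b∈)) ⟩
    n                         ∎
    where
    swap₁₂ : ∀ a b c → a + b + c ≡ b + (a + c)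
    swap₁₂ = solve-∀
  fromFirst (no ¬p0) = chainAbove lo lo≤n (λ p1 → contradiction (down 0 p1) ¬p0)

pred[m]<n : ∀ {m n} → 0 < m → m ≤ n → pred m < n
pred[m]<n {suc m} _ m<n = m<n

rowLen-antitone : ∀ {xs} → Linked _≥_ xs → ∀ i → rowLen xs (suc i) ≤ rowLen xs i
rowLen-antitone []        i       = z≤n
rowLen-antitone [-]       i       = z≤n
rowLen-antitone (x≥y ∷ _) zero    = x≥y
rowLen-antitone (_ ∷ l)   (suc i) = rowLen-antitone l i

rowLen-strict : ∀ {xs} → Linked _>_ xs → ∀ i → 0 < rowLen xs (suc i) → rowLen xs (suc i) < rowLen xs i
rowLen-strict []        i       ()
rowLen-strict [-]       i       ()
rowLen-strict (x>y ∷ _) zero    _   = x>y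
rowLen-strict (_ ∷ l)   (suc i) pos = rowLen-strict l i pos

rowLen-beyond : ∀ xs i → length xs ≤ i → rowLen xs i ≡ 0
rowLen-beyond []       i       _         = refl
rowLen-beyond (x ∷ xs) (suc i) (s≤s l≤i) = rowLen-beyond xs i l≤i

rowLen>0⇒<length : ∀ xs i → 0 < rowLen xs i → i < length xs
rowLen>0⇒<length (x ∷ xs) zero    _   = s≤s z≤n
rowLen>0⇒<length (x ∷ xs) (suc i) pos = s≤s (rowLen>0⇒<length xs i pos)

<length⇒rowLen>0 : ∀ {xs} → All (0 <_) xs → ∀ i → i < length xs → 0 < rowLen xs i
<length⇒rowLen>0 (x>0 ∷ _)  zero    _         = x>0
<length⇒rowLen>0 (_ ∷ xs>0) (suc i) (s≤s i<l) = <length⇒rowLen>0 xs>0 i i<l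

rowLen≤size : ∀ xs i → rowLen xs i ≤ size xs
rowLen≤size []       i       = z≤n
rowLen≤size (x ∷ xs) zero    = m≤m+n x (size xs)
rowLen≤size (x ∷ xs) (suc i) = ≤-trans (rowLen≤size xs i) (m≤n+m (size xs) x)

∑-rowLen : ∀ xs K → length xs ≤ K → ∑ K (rowLen xs) ≡ size xs
∑-rowLen []       K       _         = ∑-zero K (λ _ _ → refl)
∑-rowLen (x ∷ xs) (suc K) (s≤s l≤K) = trans (∑-head K (rowLen (x ∷ xs))) (cong (x +_) (∑-rowLen xs K l≤K))

length-mono-⊆ₚ : ∀ {μ λs} → All (0 <_) μ → μ ⊆ₚ λs → length μ ≤ length λs
length-mono-⊆ₚ {μ} {λs} μ>0 μ⊆λ with length μ ≤? length λs
... | yes l≤l = l≤l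
... | no  l≰l = contradiction (≤-trans (<length⇒rowLen>0 μ>0 (length λs) (≰⇒> l≰l)) (μ⊆λ (length λs)))
                             (λ pos → <⇒≢ pos (sym (rowLen-beyond λs (length λs) ≤-refl)))

addBox : List ℕ → ℕ → List ℕ
addBox []       _       = 1 ∷ []
addBox (m ∷ ms) zero    = suc m ∷ ms
addBox (m ∷ ms) (suc r) = m ∷ addBox ms r

size-addBox : ∀ μ r → size (addBox μ r) ≡ suc (size μ)
size-addBox []       r       = refl
size-addBox (m ∷ ms) zero    = refl
size-addBox (m ∷ ms) (suc r) = trans (cong (m +_) (size-addBox ms r)) (+-suc m (size ms))

rowLen-addBox : ∀ μ r → r ≤ length μ → ∀ j →
                rowLen (addBox μ r) j ≤ rowLen μ j ⊎ (j ≡ r × rowLen (addBox μ r) j ≡ suc (rowLen μ r))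
rowLen-addBox []       zero    _         zero    = inj₂ (refl , refl)
rowLen-addBox []       zero    _         (suc j) = inj₁ z≤n
rowLen-addBox (m ∷ ms) zero    _         zero    = inj₂ (refl , refl)
rowLen-addBox (m ∷ ms) zero    _         (suc j) = inj₁ ≤-refl
rowLen-addBox (m ∷ ms) (suc r) _         zero    = inj₁ ≤-refl
rowLen-addBox (m ∷ ms) (suc r) (s≤s r≤l) (suc j) with rowLen-addBox ms r r≤l j
... | inj₁ le           = inj₁ le
... | inj₂ (refl , len) = inj₂ (refl , len)

ShortOfRowBelow : List ℕ → ℕ → Set
ShortOfRowBelow μ zero    = ⊤
ShortOfRowBelow μ (suc r) = suc (suc (rowLen μ (suc r))) ≤ rowLen μ r

addBox-strict : ∀ μ r → Linked _>_ μ → r ≤ length μ → ShortOfRowBelow μ r → Linked _>_ (addBox μ r)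
addBox-strict []            zero          _          _         _   = [-]
addBox-strict (m ∷ [])      zero          _          _         _   = [-]
addBox-strict (m ∷ m′ ∷ ms) zero          (m>m′ ∷ l) _         _   = m<n⇒m<1+n m>m′ ∷ l
addBox-strict (m ∷ [])      (suc zero)    _          _         gap = gap ∷ [-]
addBox-strict (m ∷ m′ ∷ ms) (suc zero)    (_ ∷ l)    _         gap = gap ∷ addBox-strict (m′ ∷ ms) zero l z≤n tt
addBox-strict (m ∷ m′ ∷ ms) (suc (suc r)) (m>m′ ∷ l) (s≤s r≤l) gap =
  m>m′ ∷ addBox-strict (m′ ∷ ms) (suc r) l r≤l gap

addBox-positive : ∀ μ r → All (0 <_) μ → All (0 <_) (addBox μ r)
addBox-positive []       r       _            = s≤s z≤n ∷ []
addBox-positive (m ∷ ms) zero    (_ ∷ ms>0)   = s≤s z≤n ∷ ms>0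
addBox-positive (m ∷ ms) (suc r) (m>0 ∷ ms>0) = m>0 ∷ addBox-positive ms r ms>0

module _ {λs μ : List ℕ} (pλ : IsPartition λs) (sμ : IsStrictPartition μ) (μ⊆λ : μ ⊆ₚ λs)
         (maximal : ∀ ν → IsStrictPartition ν → ν ⊆ₚ λs → size ν ≤ size μ) where

  no-room-in-row : ∀ r → r ≤ length μ → ShortOfRowBelow μ r → ¬ (suc (rowLen μ r) ≤ rowLen λs r)
  no-room-in-row r r≤l short room = <-irrefl refl (subst (_≤ size μ) (size-addBox μ r) (maximal ν strict ν⊆λ))
    where
    ν = addBox μ r
    strict : IsStrictPartition ν
    strict = addBox-strict μ r (proj₁ sμ) r≤l short , addBox-positive μ r (proj₂ sμ)
    ν⊆λ : ν ⊆ₚ λs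
    ν⊆λ j with rowLen-addBox μ r r≤l j
    ... | inj₁ le           = ≤-trans le (μ⊆λ j)
    ... | inj₂ (refl , len) = subst (_≤ rowLen λs j) (sym len) room

  -- Otherwise, descending from row r one reaches a row of μ ending left of column c whose extension
  -- by one box keeps μ strict and inside λ, contradicting maximality.
  outsideBox-above-rowEnd : ∀ r c → c < rowLen λs r → rowLen μ r ≤ c → Σ ℕ λ i → i < r × rowLen μ i ≡ suc c
  outsideBox-above-rowEnd zero    c c<λ μ≤c = contradiction (≤-trans (s≤s μ≤c) c<λ) (no-room-in-row 0 z≤n tt)
  outsideBox-above-rowEnd (suc r) c c<λ μ≤c with rowLen μ r ≟ suc c
  ... | yes ends = r , ≤-refl , ends
  ... | no ¬ends with rowLen μ r ≤? c
  ...   | yes μr≤c =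
    let i , i<r , ends = outsideBox-above-rowEnd r c (≤-trans c<λ (rowLen-antitone (proj₁ pλ) r)) μr≤c
    in  i , m<n⇒m<1+n i<r , ends
  ...   | no  μr≰c =
    contradiction (≤-trans (s≤s μ≤c) c<λ) (no-room-in-row (suc r) r<l (≤-trans (s≤s (s≤s μ≤c)) long))
    where
    long : suc (suc c) ≤ rowLen μ r
    long = ≤∧≢⇒< (≰⇒> μr≰c) (¬ends ∘ sym)
    r<l : suc r ≤ length μ
    r<l = rowLen>0⇒<length μ r (≤-trans (s≤s z≤n) long)

d-≡-∑ : ∀ λs {n} (T : Filling n) → d λs T ≡ ∑[ r < length λs ] ∑[ c < rowLen λs r ] ∣ T r c ∣
d-≡-∑ λs T = trans (∑-upTo _ (length λs)) (∑-cong (length λs) (λ r _ → ∑-upTo _ (rowLen λs r)))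

weight : (λs : List ℕ) {n : ℕ} → Filling n → ℕ → ℕ → ℕ
weight λs T r c = onlyIf (c <? rowLen λs r) ∣ T r c ∣

module _ {λs : List ℕ} {n : ℕ} (pλ : IsPartition λs) {T : Filling n} (svt : IsSVT λs n T) where

  open IsSVT svt

  row≤entry : ∀ i j → InShape λs i j → ∀ a → a ∈ T i j → i ≤ toℕ a
  row≤entry zero    j _   a _   = z≤n
  row≤entry (suc i) j box a a∈ =
    let b , b∈ = nonempty i j below
    in  ≤-trans (s≤s (row≤entry i j below b b∈)) (colStrict i j below box b a b∈ a∈)
    where below = ≤-trans box (rowLen-antitone (proj₁ pλ) i)

  row<n : ∀ i j → InShape λs i j → i < n
  row<n i j box with nonempty i j box
  ... | a , a∈ = ≤-<-trans (row≤entry i j box a a∈) (toℕ<n a)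

  size≤d : ∀ {μ} → All (0 <_) μ → μ ⊆ₚ λs → size μ ≤ d λs T
  size≤d {μ} μ>0 μ⊆λ = begin
    size μ
      ≡⟨ sym (∑-rowLen μ L (length-mono-⊆ₚ {λs = λs} μ>0 μ⊆λ)) ⟩
    ∑ L (rowLen μ)
      ≤⟨ ∑-mono L (λ r _ → μ⊆λ r) ⟩
    ∑ L (rowLen λs)
      ≡⟨ ∑-cong L (λ r _ → sym (trans (∑-const (rowLen λs r) 1) (*-identityʳ _))) ⟩
    ∑[ r < L ] ∑[ c < rowLen λs r ] 1
      ≤⟨ ∑-mono L (λ r _ → ∑-mono (rowLen λs r) (λ c box → nonempty⇒∣p∣>0 (T r c) (nonempty r c box))) ⟩
    ∑[ r < L ] ∑[ c < rowLen λs r ] ∣ T r c ∣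
      ≡⟨ sym (d-≡-∑ λs T) ⟩
    d λs T ∎
    where
    open ≤-Reasoning
    L = length λs

  rowSum-bound : ∀ i k → suc k ≤ rowLen λs i → ∑[ c < suc k ] ∣ T i c ∣ + i ≤ suc k + max (T i k)
  rowSum-bound i k row = weakChain-card (T i) k i
    (λ j j≤k → nonempty i j (≤-<-trans j≤k row))
    (λ j j<k → rowWeak i j (<-trans j<k row) (≤-<-trans j<k row))
    (row≤entry i 0 (≤-<-trans z≤n row))

  colSum-bound : ∀ i k → k < rowLen λs i → ∀ N →
                 ∑[ r < N ] onlyIf (i <? r) (weight λs T r k) + suc (max (T i k)) ≤ n
  colSum-bound i k box N = begin
    ∑[ r < N ] onlyIf (i <? r) (weight λs T r k) + lo
      ≤⟨ +-monoˡ-≤ lo (∑-monoˡ _ (m≤m+n N (suc i))) ⟩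
    ∑[ r < N + suc i ] onlyIf (i <? r) (weight λs T r k) + lo
      ≡⟨ cong (_+ lo) (∑-onlyIf-> (λ r → weight λs T r k) i N) ⟩
    ∑[ s < N ] weight λs T (s + suc i) k + lo
      ≤⟨ columnChain ⟩
    n ∎
    where
    open ≤-Reasoning
    lo = suc (max (T i k))
    below : ∀ s → k < rowLen λs (suc s + suc i) → k < rowLen λs (s + suc i)
    below s above = <-≤-trans above (rowLen-antitone (proj₁ pλ) (s + suc i))
    lo≤n : lo ≤ n
    lo≤n = max-satisfies (_< n) (T i k) (nonempty i k box) (λ a _ → toℕ<n a)
    lo≤first : k < rowLen λs (suc i) → ∀ b → b ∈ T (suc i) k → lo ≤ toℕ b
    lo≤first first b b∈ =
      max-satisfies (_< toℕ b) (T i k) (nonempty i k box) (λ a a∈ → colStrict i k box first a b a∈ b∈)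
    columnChain : ∑[ s < N ] weight λs T (s + suc i) k + lo ≤ n
    columnChain = strictChain-card (λ s → T (s + suc i) k) (λ s → k <? rowLen λs (s + suc i)) below
                    (λ s → nonempty (s + suc i) k) (λ s above → colStrict (s + suc i) k (below s above) above)
                    lo lo≤n lo≤first N

module _ {λs μ : List ℕ} {n : ℕ} (pλ : IsPartition λs) (sμ : IsStrictPartition μ) (μ⊆λ : μ ⊆ₚ λs)
         (maximal : ∀ ν → IsStrictPartition ν → ν ⊆ₚ λs → size ν ≤ size μ)
         {T : Filling n} (svt : IsSVT λs n T) where

  private
    L = length λs
    ℓ = length μ
    W = size λs

    inμ : ℕ → ℕ → ℕ
    inμ r c = onlyIf (c <? rowLen μ r) ∣ T r c ∣

    aboveRowEnd : ℕ → ℕ → ℕ → ℕ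
    aboveRowEnd i r c = onlyIf (c ≟ pred (rowLen μ i)) (onlyIf (i <? r) (weight λs T r c))

    rowSum colSum : ℕ → ℕ
    rowSum i = ∑[ c < rowLen μ i ] ∣ T i c ∣
    colSum i = ∑[ r < L ] onlyIf (i <? r) (weight λs T r (pred (rowLen μ i)))

  weight-covered : ∀ r c → weight λs T r c ≤ inμ r c + ∑[ i < ℓ ] aboveRowEnd i r c
  weight-covered r c = onlyIf-≤ (c <? rowLen λs r) covered
    where
    covered : c < rowLen λs r → ∣ T r c ∣ ≤ inμ r c + ∑[ i < ℓ ] aboveRowEnd i r c
    covered c<λ with c <? rowLen μ r
    ... | yes _   = m≤m+n _ _
    ... | no  c≮μ with outsideBox-above-rowEnd pλ sμ μ⊆λ maximal r c c<λ (≮⇒≥ c≮μ)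
    ...   | i , i<r , ends =
      ≤-trans (≤-reflexive (sym covering)) (≤-trans (term≤∑ ℓ (λ i → aboveRowEnd i r c) i i<ℓ) (m≤n+m _ _))
      where
      i<ℓ : i < ℓ
      i<ℓ = rowLen>0⇒<length μ i (subst (0 <_) (sym ends) (s≤s z≤n))
      covering : aboveRowEnd i r c ≡ ∣ T r c ∣
      covering = trans (onlyIf-yes (c ≟ pred (rowLen μ i)) (cong pred (sym ends)))
                       (trans (onlyIf-yes (i <? r) i<r) (onlyIf-yes (c <? rowLen λs r) c<λ))

  ∑-inμ : ∑[ r < L ] ∑[ c < W ] inμ r c ≡ ∑[ i < ℓ ] rowSum i
  ∑-inμ = trans
    (∑-cong L (λ r _ → ∑-onlyIf-< (∣_∣ ∘ T r) (rowLen μ r) W (≤-trans (μ⊆λ r) (rowLen≤size λs r))))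
    (∑-truncate ℓ L (length-mono-⊆ₚ {λs = λs} (proj₂ sμ) μ⊆λ)
       (λ i ℓ≤i _ → cong (λ m → ∑[ c < m ] ∣ T i c ∣) (rowLen-beyond μ i ℓ≤i)))

  ∑-aboveRowEnd : ∑[ r < L ] ∑[ c < W ] ∑[ i < ℓ ] aboveRowEnd i r c ≡ ∑[ i < ℓ ] colSum i
  ∑-aboveRowEnd = begin
    ∑[ r < L ] ∑[ c < W ] ∑[ i < ℓ ] aboveRowEnd i r c
      ≡⟨ ∑-cong L (λ r _ → ∑-comm W ℓ _) ⟩
    ∑[ r < L ] ∑[ i < ℓ ] ∑[ c < W ] aboveRowEnd i r c
      ≡⟨ ∑-comm L ℓ _ ⟩
    ∑[ i < ℓ ] ∑[ r < L ] ∑[ c < W ] aboveRowEnd i r c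
      ≡⟨ ∑-cong ℓ (λ i i<ℓ → ∑-cong L (λ r _ →
          ∑-onlyIf-≡ (λ c → onlyIf (i <? r) (weight λs T r c)) _ W (rowEnd<W i i<ℓ))) ⟩
    ∑[ i < ℓ ] colSum i ∎
    where
    open ≡-Reasoning
    rowEnd<W : ∀ i → i < ℓ → pred (rowLen μ i) < W
    rowEnd<W i i<ℓ = pred[m]<n (<length⇒rowLen>0 (proj₂ sμ) i i<ℓ) (≤-trans (μ⊆λ i) (rowLen≤size λs i))

  d≤∑hooks : d λs T ≤ ∑[ i < ℓ ] (rowSum i + colSum i)
  d≤∑hooks = begin
    d λs T
      ≡⟨ d≡∑weight ⟩
    ∑[ r < L ] ∑[ c < W ] weight λs T r c
      ≤⟨ ∑-mono L (λ r _ → ∑-mono W (λ c _ → weight-covered r c)) ⟩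
    ∑[ r < L ] ∑[ c < W ] (inμ r c + ∑[ i < ℓ ] aboveRowEnd i r c)
      ≡⟨ ∑-cong L (λ r _ → ∑-distrib-+ W _ _) ⟩
    ∑[ r < L ] (∑[ c < W ] inμ r c + ∑[ c < W ] ∑[ i < ℓ ] aboveRowEnd i r c)
      ≡⟨ ∑-distrib-+ L _ _ ⟩
    ∑[ r < L ] ∑[ c < W ] inμ r c + ∑[ r < L ] ∑[ c < W ] ∑[ i < ℓ ] aboveRowEnd i r c
      ≡⟨ cong₂ _+_ ∑-inμ ∑-aboveRowEnd ⟩
    ∑ ℓ rowSum + ∑ ℓ colSum
      ≡⟨ sym (∑-distrib-+ ℓ rowSum colSum) ⟩
    ∑[ i < ℓ ] (rowSum i + colSum i) ∎
    where
    open ≤-Reasoning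
    d≡∑weight : d λs T ≡ ∑[ r < L ] ∑[ c < W ] weight λs T r c
    d≡∑weight = trans (d-≡-∑ λs T)
                  (∑-cong L (λ r _ → sym (∑-onlyIf-< (∣_∣ ∘ T r) (rowLen λs r) W (rowLen≤size λs r))))

  hook-bound : ∀ i → i < ℓ → rowSum i + colSum i ≤ rowLen μ i + (n ∸ suc i)
  hook-bound i i<ℓ with rowLen μ i | μ⊆λ i | <length⇒rowLen>0 (proj₂ sμ) i i<ℓ
  ... | suc k | row | _ =
    combine (rowSum-bound pλ svt i k row) (colSum-bound pλ svt i k row L) (row<n pλ svt i k row)
    where
    -- the pivot max (T i k) cancels between the row chain and the column chain
    combine : ∀ {R C a m} → R + i ≤ a + m → C + suc m ≤ n → i < n → R + C ≤ a + (n ∸ suc i)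
    combine {R} {C} {a} {m} rowChain colChain i<n =
      subst (R + C ≤_) (+-∸-assoc a i<n)
        (m+n≤o⇒m≤o∸n (R + C) (+-cancelʳ-≤ m _ _ (begin
          R + C + suc i + m          ≡⟨ regroupˡ R C i m ⟩
          (R + i) + (C + suc m)      ≤⟨ +-mono-≤ rowChain colChain ⟩
          a + m + n                  ≡⟨ regroupʳ a m n ⟩
          a + n + m                  ∎)))
      where
      open ≤-Reasoning
      regroupˡ : ∀ R C i m → R + C + suc i + m ≡ (R + i) + (C + suc m)
      regroupˡ = solve-∀
      regroupʳ : ∀ a m n → a + m + n ≡ a + n + m
      regroupʳ = solve-∀

  d≤size+∑ : d λs T ≤ size μ + ∑[ i < ℓ ] (n ∸ suc i)
  d≤size+∑ = begin
    d λs T                                      ≤⟨ d≤∑hooks ⟩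
    ∑[ i < ℓ ] (rowSum i + colSum i)            ≤⟨ ∑-mono ℓ hook-bound ⟩
    ∑[ i < ℓ ] (rowLen μ i + (n ∸ suc i))       ≡⟨ ∑-distrib-+ ℓ (rowLen μ) _ ⟩
    ∑ ℓ (rowLen μ) + ∑[ i < ℓ ] (n ∸ suc i)     ≡⟨ cong (_+ ∑[ i < ℓ ] (n ∸ suc i)) (∑-rowLen μ ℓ ≤-refl) ⟩
    size μ + ∑[ i < ℓ ] (n ∸ suc i)             ∎
    where open ≤-Reasoning

split-under-caps : ∀ (cap : ℕ → ℕ) K x → x ≤ ∑ K cap → Σ (ℕ → ℕ) λ e → (∀ i → e i ≤ cap i) × ∑ K e ≡ x
split-under-caps cap zero    x x≤0 = (λ _ → 0) , (λ _ → z≤n) , sym (n≤0⇒n≡0 x≤0)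
split-under-caps cap (suc K) x x≤∑ = extend (split-under-caps cap K (x ∸ cap K) rest≤∑)
  where
  rest≤∑ : x ∸ cap K ≤ ∑ K cap
  rest≤∑ = subst (x ∸ cap K ≤_) (m+n∸n≡m (∑ K cap) (cap K)) (∸-monoˡ-≤ (cap K) x≤∑)
  extend : Σ (ℕ → ℕ) (λ e → (∀ i → e i ≤ cap i) × ∑ K e ≡ x ∸ cap K) →
           Σ (ℕ → ℕ) (λ e → (∀ i → e i ≤ cap i) × ∑ (suc K) e ≡ x)
  extend (e , e≤cap , ∑e) = e′ , e′≤cap , ∑e′
    where
    e′ : ℕ → ℕ
    e′ i with i ≟ K
    ... | yes _ = cap K ⊓ x
    ... | no  _ = e i
    e′≤cap : ∀ i → e′ i ≤ cap i
    e′≤cap i with i ≟ K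
    ... | yes refl = m⊓n≤m (cap K) x
    ... | no  _    = e≤cap i
    e′-below : ∀ i → i < K → e′ i ≡ e i
    e′-below i i<K with i ≟ K
    ... | yes refl = contradiction i<K (<-irrefl refl)
    ... | no  _    = refl
    e′-last : e′ K ≡ cap K ⊓ x
    e′-last with K ≟ K
    ... | yes _  = refl
    ... | no K≢K = contradiction refl K≢K
    ∑e′ : ∑ (suc K) e′ ≡ x
    ∑e′ = begin
      ∑ K e′ + e′ K            ≡⟨ cong₂ _+_ (trans (∑-cong K e′-below) ∑e) e′-last ⟩
      (x ∸ cap K) + cap K ⊓ x  ≡⟨ +-comm (x ∸ cap K) _ ⟩
      cap K ⊓ x + (x ∸ cap K)  ≡⟨ m⊓n+n∸m≡n (cap K) x ⟩
      x                        ∎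
      where open ≡-Reasoning

module _ {n : ℕ} {μ : List ℕ} (sμ : IsStrictPartition μ) (rows<n : ∀ i → i < length μ → i < n)
         (e : ℕ → ℕ) (e≤ : ∀ i → e i ≤ n ∸ suc i) where

  private
    extra : ℕ → ℕ → ℕ
    extra i j = onlyIf (j ≟ pred (rowLen μ i)) (e i)

    extra-notLast : ∀ i j → suc j < rowLen μ i → extra i j ≡ 0
    extra-notLast i j j+1<μ = onlyIf-no (j ≟ pred (rowLen μ i)) (<⇒≢ (<⇒≤pred j+1<μ))

    inShape⇒i<n : ∀ i j → InShape μ i j → i < n
    inShape⇒i<n i j box = rows<n i (rowLen>0⇒<length μ i (≤-<-trans z≤n box))

    fits : ∀ i j → InShape μ i j → suc (extra i j) + i ≤ n
    fits i j box = begin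
      suc (extra i j + i)
        ≡⟨ sym (+-suc (extra i j) i) ⟩
      extra i j + suc i
        ≤⟨ +-monoˡ-≤ (suc i) (≤-trans (onlyIf-≤ (j ≟ pred (rowLen μ i)) (λ _ → ≤-refl)) (e≤ i)) ⟩
      (n ∸ suc i) + suc i
        ≡⟨ m∸n+n≡m (inShape⇒i<n i j box) ⟩
      n ∎
      where open ≤-Reasoning

  staircase : Filling n
  staircase i j = interval i (suc (extra i j))

  staircase-svt : IsSVT μ n staircase
  staircase-svt = record { nonempty = nonempty ; colStrict = colStrict ; rowWeak = rowWeak }
    where
    entry≤ : ∀ i j a → a ∈ staircase i j → toℕ a ≤ extra i j + i
    entry≤ i j a a∈ = ≤-pred (proj₂ (∈-interval⁻ i _ a a∈))
    nonempty : ∀ i j → InShape μ i j → Nonempty (staircase i j)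
    nonempty i j box = fromℕ< i<n , ∈-interval⁺ i _ (fromℕ< i<n) (≤-reflexive (sym (toℕ-fromℕ< i<n)))
                                       (subst (_< suc (extra i j + i)) (sym (toℕ-fromℕ< i<n)) (s≤s (m≤n+m i _)))
      where i<n = inShape⇒i<n i j box
    colStrict : ∀ i j → InShape μ i j → InShape μ (suc i) j →
                ∀ a b → a ∈ staircase i j → b ∈ staircase (suc i) j → toℕ a < toℕ b
    colStrict i j _ above a b a∈ b∈ = ≤-trans (s≤s (subst (λ x → toℕ a ≤ x + i) (extra-notLast i j j+1<μ) (entry≤ i j a a∈)))
                                              (proj₁ (∈-interval⁻ (suc i) _ b b∈))
      where j+1<μ = ≤-<-trans above (rowLen-strict (proj₁ sμ) i (≤-<-trans z≤n above))
    rowWeak : ∀ i j → InShape μ i j → InShape μ i (suc j) →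
              ∀ a b → a ∈ staircase i j → b ∈ staircase i (suc j) → toℕ a ≤ toℕ b
    rowWeak i j _ next a b a∈ b∈ = ≤-trans (subst (λ x → toℕ a ≤ x + i) (extra-notLast i j next) (entry≤ i j a a∈))
                                           (proj₁ (∈-interval⁻ i _ b b∈))

  d-staircase : d μ staircase ≡ size μ + ∑[ i < length μ ] e i
  d-staircase = begin
    d μ staircase
      ≡⟨ d-≡-∑ μ staircase ⟩
    ∑[ i < ℓ ] ∑[ j < rowLen μ i ] ∣ staircase i j ∣
      ≡⟨ ∑-cong ℓ (λ i i<ℓ → ∑-cong (rowLen μ i) (λ j box → ∣interval∣ i _ (fits i j box))) ⟩
    ∑[ i < ℓ ] ∑[ j < rowLen μ i ] (1 + extra i j)
      ≡⟨ ∑-cong ℓ (λ i i<ℓ → row i (<length⇒rowLen>0 (proj₂ sμ) i i<ℓ)) ⟩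
    ∑[ i < ℓ ] (rowLen μ i + e i)
      ≡⟨ ∑-distrib-+ ℓ (rowLen μ) e ⟩
    ∑ ℓ (rowLen μ) + ∑ ℓ e
      ≡⟨ cong (_+ ∑ ℓ e) (∑-rowLen μ ℓ ≤-refl) ⟩
    size μ + ∑ ℓ e ∎
    where
    open ≡-Reasoning
    ℓ = length μ
    row : ∀ i → 0 < rowLen μ i → ∑[ j < rowLen μ i ] (1 + extra i j) ≡ rowLen μ i + e i
    row i μi>0 = trans (∑-distrib-+ (rowLen μ i) (λ _ → 1) (extra i))
                       (cong₂ _+_ (trans (∑-const (rowLen μ i) 1) (*-identityʳ _))
                                  (∑-onlyIf-≡ (λ _ → e i) (pred (rowLen μ i)) (rowLen μ i) (pred[m]<n μi>0 ≤-refl)))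

svt-of-degree : ∀ {n} μ → IsStrictPartition μ → (∀ i → i < length μ → i < n) →
                ∀ D → size μ ≤ D → D ≤ size μ + ∑[ i < length μ ] (n ∸ suc i) →
                Σ (Filling n) λ S → IsSVT μ n S × d μ S ≡ D
svt-of-degree {n} μ sμ rows<n D μ≤D D≤
  with split-under-caps (λ i → n ∸ suc i) (length μ) (D ∸ size μ)
         (subst (D ∸ size μ ≤_) (m+n∸m≡n (size μ) _) (∸-monoˡ-≤ (size μ) D≤))
... | e , e≤ , ∑e = staircase sμ rows<n e e≤ , staircase-svt sμ rows<n e e≤ ,
                    trans (d-staircase sμ rows<n e e≤) (trans (cong (size μ +_) ∑e) (m+[n∸m]≡n μ≤D))

lemma5p2 : (λs μ : List ℕ) (n : ℕ) → 1 ≤ n → IsPartition λs →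
    IsStrictPartition μ → μ ⊆ₚ λs →
    (∀ ν → IsStrictPartition ν → ν ⊆ₚ λs → size ν ≤ size μ) →
    (T : Filling n) → IsSVT λs n T →
    Σ (Filling n) (λ S → IsSVT μ n S × d μ S ≡ d λs T)
-- The hypothesis 1 ≤ n is not needed: the entries of T already bound the number of rows of μ by n.
lemma5p2 λs μ n _ pλ sμ μ⊆λ maximal T svt =
  svt-of-degree μ sμ rows<n (d λs T) (size≤d pλ svt (proj₂ sμ) μ⊆λ) (d≤size+∑ pλ sμ μ⊆λ maximal svt)
  where
  rows<n : ∀ i → i < length μ → i < n
  rows<n i i<ℓ = row<n pλ svt i 0 (≤-trans (<length⇒rowLen>0 (proj₂ sμ) i i<ℓ) (μ⊆λ i))
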